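{- Let $K$ be a field, $n\le r$, and let $(A_1,\ldots,A_p)$ be a tuple of matrices in $M_n(K)$ having a commuting extension $(Z_1,\ldots,Z_p)$ of size $r$, with $Z_i=\begin{pmatrix} A_i & B_i\\ C_i & D_i\end{pmatrix}$. Let $k,l,m\in\{1,\ldots,p\}$ be pairwise distinct. If $\dim(\operatorname{Im}[A_k,A_l]+\operatorname{Im}[A_k,A_m])=3(r-n)$, $\dim\operatorname{Im}[A_k,A_l]=2(r-n)$ and $\dim\operatorname{Im}[A_k,A_m]=2(r-n)$, then $\operatorname{Im}(B_k)=\operatorname{Im}[A_k,A_l]\cap\operatorname{Im}[A_k,A_m]$.
   Context: $[A,B]=AB-BA$, $\operatorname{Im}A$ is the column space. A commuting extension of size $r$ of $(A_1,\ldots,A_p)$ is a tuple of pairwise commuting $r\times r$ matrices $Z_i=\begin{pmatrix} A_i & B_i\\ C_i & D_i\end{pmatrix}$ with $B_i\in M_{n,r-n}(K)$, $C_i\in M_{r-n,n}(K)$, $D_i\in M_{r-n}(K)$. -}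

module Defs where

open import Level using (_⊔_) renaming (suc to lsuc)
open import Data.Nat using (ℕ; zero; suc) renaming (_+_ to _+ℕ_)
open import Data.Fin using (Fin; zero; suc; splitAt)
open import Data.Sum using (inj₁; inj₂)
open import Data.Product using (Σ; ∃; _×_; _,_)
open import Relation.Nullary using (¬_)
open import Algebra.Bundles using (CommutativeRing)

record Field c ℓ : Set (lsuc (c ⊔ ℓ)) where
  field
    commutativeRing : CommutativeRing c ℓ
  open CommutativeRing commutativeRing public
  field
    1≉0 : ¬ (1# ≈ 0#)
    inverse : ∀ x → ¬ (x ≈ 0#) → Σ Carrier λ y → x * y ≈ 1#

module LinAlg {c ℓ} (K : Field c ℓ) where
  open Field K using (Carrier; _≈_; _+_; _*_; _-_; 0#; 1#)

  Vector : ℕ → Set c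
  Vector n = Fin n → Carrier

  Matrix : ℕ → ℕ → Set c
  Matrix m n = Fin m → Fin n → Carrier

  sumF : ∀ n → (Fin n → Carrier) → Carrier
  sumF zero    f = 0#
  sumF (suc n) f = f zero + sumF n (λ i → f (suc i))

  _≈ᵥ_ : ∀ {n} → Vector n → Vector n → Set ℓ
  u ≈ᵥ v = ∀ i → u i ≈ v i

  _≈ₘ_ : ∀ {m n} → Matrix m n → Matrix m n → Set ℓ
  X ≈ₘ Y = ∀ i j → X i j ≈ Y i j

  _+ᵥ_ : ∀ {n} → Vector n → Vector n → Vector n
  (u +ᵥ v) i = u i + v i

  0ᵥ : ∀ {n} → Vector n
  0ᵥ i = 0#

  _*ₘ_ : ∀ {m n o} → Matrix m n → Matrix n o → Matrix m o
  _*ₘ_ {n = n} X Y i k = sumF n (λ j → X i j * Y j k)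

  _·_ : ∀ {m n} → Matrix m n → Vector n → Vector m
  _·_ {n = n} X u i = sumF n (λ j → X i j * u j)

  _-ₘ_ : ∀ {m n} → Matrix m n → Matrix m n → Matrix m n
  (X -ₘ Y) i j = X i j - Y i j

  [_,_] : ∀ {n} → Matrix n n → Matrix n n → Matrix n n
  [ X , Y ] = (X *ₘ Y) -ₘ (Y *ₘ X)

  block : ∀ {n s} → Matrix n n → Matrix n s → Matrix s n → Matrix s s
        → Matrix (n +ℕ s) (n +ℕ s)
  block {n} A B C D i j with splitAt n i | splitAt n j
  ... | inj₁ a | inj₁ b = A a b
  ... | inj₁ a | inj₂ b = B a b
  ... | inj₂ a | inj₁ b = C a b
  ... | inj₂ a | inj₂ b = D a b

  Subset : ℕ → Set (lsuc (c ⊔ ℓ))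
  Subset n = Vector n → Set (c ⊔ ℓ)

  Im : ∀ {m n} → Matrix m n → Subset m
  Im X v = Σ _ λ u → (X · u) ≈ᵥ v

  _⊕_ : ∀ {m} → Subset m → Subset m → Subset m
  (U ⊕ W) v = Σ _ λ u → Σ _ λ w → U u × W w × ((u +ᵥ w) ≈ᵥ v)

  _∩_ : ∀ {m} → Subset m → Subset m → Subset m
  (U ∩ W) v = U v × W v

  _≐_ : ∀ {m} → Subset m → Subset m → Set (c ⊔ ℓ)
  U ≐ W = ∀ v → ((U v → W v) × (W v → U v))

  lincomb : ∀ {m d} → (Fin d → Carrier) → (Fin d → Vector m) → Vector m
  lincomb {d = d} a v i = sumF d (λ j → a j * v j i)

  LinIndep : ∀ {m d} → (Fin d → Vector m) → Set (c ⊔ ℓ)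
  LinIndep {d = d} v = ∀ (a : Fin d → Carrier) → lincomb a v ≈ᵥ 0ᵥ → ∀ j → a j ≈ 0#

  IsBasis : ∀ {m d} → Subset m → (Fin d → Vector m) → Set (c ⊔ ℓ)
  IsBasis {d = d} U v =
    (∀ j → U (v j)) × LinIndep v × (∀ w → U w → Σ (Fin d → Carrier) λ a → lincomb a v ≈ᵥ w)

  HasDim : ∀ {m} → Subset m → ℕ → Set (c ⊔ ℓ)
  HasDim {m} U d = Σ (Fin d → Vector m) λ v → IsBasis U v

  CommutingExtension : ∀ {n s p} → (Fin p → Matrix n n) → (Fin p → Matrix n s)
    → (Fin p → Matrix s n) → (Fin p → Matrix s s) → Set ℓ
  CommutingExtension {p = p} A B C D =
    ∀ (i j : Fin p) → (block (A i) (B i) (C i) (D i) *ₘ block (A j) (B j) (C j) (D j))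
                     ≈ₘ (block (A j) (B j) (C j) (D j) *ₘ block (A i) (B i) (C i) (D i))

-- The top-left block of Z_k Z_l = Z_l Z_k gives [A_k, A_l] = B_l C_k − B_k C_l, so Im [A_k, A_l] lies in
-- the image of the n × 2s matrix (B_k ∣ B_l), and Im [A_k, A_l] + Im [A_k, A_m] in the image of the
-- n × 3s matrix (B_k ∣ B_l ∣ B_m). A subspace of dimension d inside the image of a matrix with d columns
-- is that whole image, and the matrix is injective. The first half gives Im B_k ⊆ Im [A_k, A_l] and
-- Im B_k ⊆ Im [A_k, A_m]. Conversely, if v = [A_k, A_l] x = [A_k, A_m] x′, subtracting the two
-- expansions of v gives a kernel vector of (B_k ∣ B_l ∣ B_m) whose middle block is C_k x; hence C_k x = 0
-- and v = B_k (−C_l x).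
--
-- The dimension fact is proved constructively with determinants: the coordinates of a basis in terms of
-- the d columns form a square matrix which is injective, hence (since a singular matrix cannot fail to
-- have a nontrivial kernel) of nonzero determinant, hence invertible via its adjugate.
module Submission where

open import Defs
open import Level using (_⊔_)
open import Data.Nat as ℕ using (ℕ; zero; suc)
import Data.Nat.Properties as ℕₚ
open import Data.Fin using (Fin; zero; suc; toℕ; inject₁; _↑ˡ_; _↑ʳ_; punchIn; punchOut)
open import Data.Fin.Properties
  using (_≟_; suc-injective; toℕ-injective; toℕ-inject₁; splitAt-↑ˡ; splitAt-↑ʳ;
         punchInᵢ≢i; punchIn-punchOut; punchIn-injective; sequence)
open import Data.Vec.Functional using (_∷_; _++_; updateAt)
open import Data.Vec.Functional.Properties
  using (lookup-++ˡ; lookup-++ʳ; updateAt-updates; updateAt-minimal; updateAt-commutes; updateAt-id-local)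
open import Data.Sum using (_⊎_; inj₁; inj₂)
open import Data.Product using (Σ; _×_; _,_; proj₁; proj₂)
open import Data.Empty using (⊥-elim)
open import Function using (_∘_; _∘₂_; const)
open import Effect.Monad using (RawMonad)
open import Relation.Nullary using (¬_; yes; no)
open import Relation.Nullary.Negation using (¬¬-Monad)
open import Relation.Binary using (tri<; tri≈; tri>)
open import Relation.Binary.PropositionalEquality as ≡ using (_≡_; _≢_)

Adjacent : ∀ {n} → Fin n → Fin n → Set
Adjacent p q = toℕ q ≡ suc (toℕ p)

adjacent⇒≢ : ∀ {n} {p q : Fin n} → Adjacent p q → p ≢ q
adjacent⇒≢ adj ≡.refl = ℕₚ.1+n≢n (≡.sym adj)

adjacent-punchOut : ∀ {n} {i p q : Fin (suc n)} (i≢p : i ≢ p) (i≢q : i ≢ q) →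
                    Adjacent p q → Adjacent (punchOut i≢p) (punchOut i≢q)
adjacent-punchOut {i = zero} {zero}          i≢p i≢q adj = ⊥-elim (i≢p ≡.refl)
adjacent-punchOut {i = zero} {suc p} {zero}  i≢p i≢q adj = ⊥-elim (i≢q ≡.refl)
adjacent-punchOut {i = zero} {suc p} {suc q} i≢p i≢q adj = ℕₚ.suc-injective adj
adjacent-punchOut {suc n} {suc i}       {zero}  {zero}        i≢p i≢q ()
adjacent-punchOut {suc n} {suc zero}    {zero}  {suc zero}    i≢p i≢q adj = ⊥-elim (i≢q ≡.refl)
adjacent-punchOut {suc (suc n)} {suc (suc i)} {zero} {suc zero} i≢p i≢q adj = ≡.refl
adjacent-punchOut {suc n} {suc i}       {zero}  {suc (suc q)} i≢p i≢q ()
adjacent-punchOut {suc n} {suc i}       {suc p} {zero}        i≢p i≢q ()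
adjacent-punchOut {suc n} {suc i}       {suc p} {suc q}       i≢p i≢q adj =
  ≡.cong suc (adjacent-punchOut (i≢p ∘ ≡.cong suc) (i≢q ∘ ≡.cong suc) (ℕₚ.suc-injective adj))

adjacent-punchIn : ∀ {n} {p q : Fin (suc n)} → Adjacent p q → ∀ a →
                   punchIn p a ≡ punchIn q a ⊎ (punchIn p a ≡ q × punchIn q a ≡ p)
adjacent-punchIn {p = zero}  {zero}        ()  a
adjacent-punchIn {p = zero}  {suc zero}    adj zero    = inj₂ (≡.refl , ≡.refl)
adjacent-punchIn {p = zero}  {suc zero}    adj (suc a) = inj₁ ≡.refl
adjacent-punchIn {p = zero}  {suc (suc q)} ()  a
adjacent-punchIn {p = suc p} {zero}        ()  a
adjacent-punchIn {p = suc p} {suc q}       adj zero    = inj₁ ≡.refl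
adjacent-punchIn {p = suc p} {suc q}       adj (suc a) with adjacent-punchIn (ℕₚ.suc-injective adj) a
... | inj₁ eq          = inj₁ (≡.cong suc eq)
... | inj₂ (eq₁ , eq₂) = inj₂ (≡.cong suc eq₁ , ≡.cong suc eq₂)

module LinearAlgebra {c ℓ} (K : Field c ℓ) where
  open Field K hiding (zero)
  open LinAlg K
  open import Relation.Binary.Reasoning.Setoid setoid
  open import Algebra.Properties.Ring ring using (-‿distribˡ-*; -‿distribʳ-*; x+x≈x⇒x≈0)
  open import Algebra.Properties.Group +-group using (ε⁻¹≈ε; ⁻¹-involutive; inverseʳ-unique)
  open import Algebra.Properties.AbelianGroup +-abelianGroup using (⁻¹-∙-comm)
  open import Algebra.Properties.CommutativeSemigroup +-commutativeSemigroup using (interchange)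
  open import Algebra.Properties.CommutativeSemigroup *-commutativeSemigroup using (x∙yz≈y∙xz)
  open import Algebra.Solver.Ring.NaturalCoefficients.Default commutativeSemiring
    using (solve; _:=_; _:+_; _:*_)

  [x+z]-[y+z]≈x-y : ∀ x y z → (x + z) - (y + z) ≈ x - y
  [x+z]-[y+z]≈x-y x y z = begin
    (x + z) - (y + z)       ≈⟨ +-congˡ (⁻¹-∙-comm y z) ⟨
    (x + z) + (- y + - z)   ≈⟨ interchange x z (- y) (- z) ⟩
    (x - y) + (z - z)       ≈⟨ +-congˡ (-‿inverseʳ z) ⟩
    (x - y) + 0#            ≈⟨ +-identityʳ _ ⟩
    x - y                   ∎

  x+y≈z+w⇒x-z≈w-y : ∀ {x y z w} → x + y ≈ z + w → x - z ≈ w - y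
  x+y≈z+w⇒x-z≈w-y {x} {y} {z} {w} x+y≈z+w = begin
    x - z               ≈⟨ [x+z]-[y+z]≈x-y x z y ⟨
    (x + y) - (z + y)   ≈⟨ +-cong x+y≈z+w (-‿cong (+-comm z y)) ⟩
    (z + w) - (y + z)   ≈⟨ +-congʳ (+-comm z w) ⟩
    (w + z) - (y + z)   ≈⟨ [x+z]-[y+z]≈x-y w y z ⟩
    w - y               ∎

  [x-y]+[z-w]≈[x+z]-[y+w] : ∀ x y z w → (x - y) + (z - w) ≈ (x + z) - (y + w)
  [x-y]+[z-w]≈[x+z]-[y+w] x y z w = trans (interchange x (- y) z (- w)) (+-congˡ (⁻¹-∙-comm y w))

  sumF-cong : ∀ n {f g : Fin n → Carrier} → (∀ i → f i ≈ g i) → sumF n f ≈ sumF n g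
  sumF-cong zero    f≈g = refl
  sumF-cong (suc n) f≈g = +-cong (f≈g zero) (sumF-cong n (f≈g ∘ suc))

  sumF-zero : ∀ n {f : Fin n → Carrier} → (∀ i → f i ≈ 0#) → sumF n f ≈ 0#
  sumF-zero zero    f≈0 = refl
  sumF-zero (suc n) f≈0 = trans (+-cong (f≈0 zero) (sumF-zero n (f≈0 ∘ suc))) (+-identityˡ 0#)

  sumF-distrib-+ : ∀ n (f g : Fin n → Carrier) → sumF n (λ i → f i + g i) ≈ sumF n f + sumF n g
  sumF-distrib-+ zero    f g = sym (+-identityˡ 0#)
  sumF-distrib-+ (suc n) f g = trans (+-congˡ (sumF-distrib-+ n (f ∘ suc) (g ∘ suc))) (interchange _ _ _ _)

  *-distribˡ-sumF : ∀ n a (f : Fin n → Carrier) → a * sumF n f ≈ sumF n (λ i → a * f i)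
  *-distribˡ-sumF zero    a f = zeroʳ a
  *-distribˡ-sumF (suc n) a f = trans (distribˡ a _ _) (+-congˡ (*-distribˡ-sumF n a (f ∘ suc)))

  *-distribʳ-sumF : ∀ n a (f : Fin n → Carrier) → sumF n f * a ≈ sumF n (λ i → f i * a)
  *-distribʳ-sumF zero    a f = zeroˡ a
  *-distribʳ-sumF (suc n) a f = trans (distribʳ a _ _) (+-congˡ (*-distribʳ-sumF n a (f ∘ suc)))

  -‿distrib-sumF : ∀ n (f : Fin n → Carrier) → - sumF n f ≈ sumF n (λ i → - f i)
  -‿distrib-sumF zero    f = ε⁻¹≈ε
  -‿distrib-sumF (suc n) f = trans (sym (⁻¹-∙-comm _ _)) (+-congˡ (-‿distrib-sumF n (f ∘ suc)))

  sumF-comm : ∀ m n (f : Fin m → Fin n → Carrier) →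
              sumF m (λ i → sumF n (f i)) ≈ sumF n (λ j → sumF m (λ i → f i j))
  sumF-comm zero    n f = sym (sumF-zero n (λ _ → refl))
  sumF-comm (suc m) n f = trans (+-congˡ (sumF-comm m n (f ∘ suc))) (sym (sumF-distrib-+ n (f zero) _))

  sumF-++ : ∀ m n (f : Fin (m ℕ.+ n) → Carrier) →
            sumF (m ℕ.+ n) f ≈ sumF m (λ i → f (i ↑ˡ n)) + sumF n (λ j → f (m ↑ʳ j))
  sumF-++ zero    n f = sym (+-identityˡ _)
  sumF-++ (suc m) n f = trans (+-congˡ (sumF-++ m n (f ∘ suc))) (sym (+-assoc _ _ _))

  sumF-single : ∀ n (f : Fin n → Carrier) p → (∀ i → i ≢ p → f i ≈ 0#) → sumF n f ≈ f p
  sumF-single (suc n) f zero    f≈0 =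
    trans (+-congˡ (sumF-zero n (λ i → f≈0 (suc i) λ ()))) (+-identityʳ _)
  sumF-single (suc n) f (suc p) f≈0 = trans
    (+-cong (f≈0 zero λ ()) (sumF-single n (f ∘ suc) p (λ i i≢p → f≈0 (suc i) (i≢p ∘ suc-injective))))
    (+-identityˡ _)

  sumF-pair : ∀ n (f : Fin n → Carrier) p q → p ≢ q → (∀ i → i ≢ p → i ≢ q → f i ≈ 0#) →
              sumF n f ≈ f p + f q
  sumF-pair (suc n) f zero    zero    p≢q f≈0 = ⊥-elim (p≢q ≡.refl)
  sumF-pair (suc n) f zero    (suc q) p≢q f≈0 =
    +-congˡ (sumF-single n (f ∘ suc) q (λ i i≢q → f≈0 (suc i) (λ ()) (i≢q ∘ suc-injective)))
  sumF-pair (suc n) f (suc p) zero    p≢q f≈0 = trans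
    (+-congˡ (sumF-single n (f ∘ suc) p (λ i i≢p → f≈0 (suc i) (i≢p ∘ suc-injective) (λ ()))))
    (+-comm _ _)
  sumF-pair (suc n) f (suc p) (suc q) p≢q f≈0 = trans
    (+-cong (f≈0 zero (λ ()) (λ ()))
            (sumF-pair n (f ∘ suc) p q (p≢q ∘ ≡.cong suc)
              (λ i i≢p i≢q → f≈0 (suc i) (i≢p ∘ suc-injective) (i≢q ∘ suc-injective))))
    (+-identityˡ _)

  ≡⇒≈ᵥ : ∀ {n} {u v : Vector n} → u ≡ v → u ≈ᵥ v
  ≡⇒≈ᵥ ≡.refl _ = refl

  -ᵥ_ : ∀ {n} → Vector n → Vector n
  (-ᵥ u) i = - u i

  ·-cong : ∀ {m n} (X : Matrix m n) {u w : Vector n} → u ≈ᵥ w → (X · u) ≈ᵥ (X · w)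
  ·-cong {n = n} X u≈w i = sumF-cong n (λ j → *-congˡ (u≈w j))

  ·-congˡ : ∀ {m n} {X Y : Matrix m n} → X ≈ₘ Y → ∀ u → (X · u) ≈ᵥ (Y · u)
  ·-congˡ {n = n} X≈Y u i = sumF-cong n (λ j → *-congʳ (X≈Y i j))

  ·-zeroʳ : ∀ {m n} (X : Matrix m n) {u : Vector n} → u ≈ᵥ 0ᵥ → (X · u) ≈ᵥ 0ᵥ
  ·-zeroʳ {n = n} X u≈0 i = sumF-zero n (λ j → trans (*-congˡ (u≈0 j)) (zeroʳ _))

  ·-distrib-+ : ∀ {m n} (X : Matrix m n) u w → (X · (u +ᵥ w)) ≈ᵥ ((X · u) +ᵥ (X · w))
  ·-distrib-+ {n = n} X u w i =
    trans (sumF-cong n (λ j → distribˡ (X i j) (u j) (w j))) (sumF-distrib-+ n _ _)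

  ·-neg : ∀ {m n} (X : Matrix m n) u → (X · (-ᵥ u)) ≈ᵥ (-ᵥ (X · u))
  ·-neg {n = n} X u i =
    trans (sumF-cong n (λ j → sym (-‿distribʳ-* (X i j) (u j)))) (sym (-‿distrib-sumF n _))

  -ₘ-· : ∀ {m n} (X Y : Matrix m n) u → ((X -ₘ Y) · u) ≈ᵥ ((X · u) +ᵥ (-ᵥ (Y · u)))
  -ₘ-· {n = n} X Y u i = begin
    sumF n (λ j → (X i j - Y i j) * u j)       ≈⟨ sumF-cong n (λ j → distribʳ (u j) (X i j) (- Y i j)) ⟩
    sumF n (λ j → X i j * u j + - Y i j * u j) ≈⟨ sumF-distrib-+ n _ _ ⟩
    (X · u) i + sumF n (λ j → - Y i j * u j)
      ≈⟨ +-congˡ (sumF-cong n (λ j → sym (-‿distribˡ-* (Y i j) (u j)))) ⟩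
    (X · u) i + sumF n (λ j → - (Y i j * u j)) ≈⟨ +-congˡ (sym (-‿distrib-sumF n _)) ⟩
    (X · u) i - (Y · u) i                      ∎

  *ₘ-· : ∀ {m n o} (X : Matrix m n) (Y : Matrix n o) u → ((X *ₘ Y) · u) ≈ᵥ (X · (Y · u))
  *ₘ-· {n = n} {o} X Y u i = begin
    sumF o (λ k → sumF n (λ j → X i j * Y j k) * u k)   ≈⟨ sumF-cong o (λ k → *-distribʳ-sumF n (u k) _) ⟩
    sumF o (λ k → sumF n (λ j → X i j * Y j k * u k))   ≈⟨ sumF-comm o n _ ⟩
    sumF n (λ j → sumF o (λ k → X i j * Y j k * u k))
      ≈⟨ sumF-cong n (λ j → sumF-cong o (λ k → *-assoc _ _ _)) ⟩
    sumF n (λ j → sumF o (λ k → X i j * (Y j k * u k)))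
      ≈⟨ sumF-cong n (λ j → sym (*-distribˡ-sumF o (X i j) _)) ⟩
    sumF n (λ j → X i j * (Y · u) j)                    ∎

  ·-lincomb : ∀ {m n d} (X : Matrix m n) (a : Fin d → Carrier) (us : Fin d → Vector n) →
              (X · lincomb a us) ≈ᵥ lincomb a (λ j → X · us j)
  ·-lincomb {n = n} {d} X a us i = begin
    sumF n (λ t → X i t * sumF d (λ j → a j * us j t))   ≈⟨ sumF-cong n (λ t → *-distribˡ-sumF d (X i t) _) ⟩
    sumF n (λ t → sumF d (λ j → X i t * (a j * us j t))) ≈⟨ sumF-comm n d _ ⟩
    sumF d (λ j → sumF n (λ t → X i t * (a j * us j t)))
      ≈⟨ sumF-cong d (λ j → sumF-cong n (λ t → x∙yz≈y∙xz _ _ _)) ⟩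
    sumF d (λ j → sumF n (λ t → a j * (X i t * us j t)))
      ≈⟨ sumF-cong d (λ j → sym (*-distribˡ-sumF n (a j) _)) ⟩
    sumF d (λ j → a j * (X · us j) i)                    ∎

  lincomb-cong : ∀ {m d} (a : Fin d → Carrier) {us vs : Fin d → Vector m} →
                 (∀ j → us j ≈ᵥ vs j) → lincomb a us ≈ᵥ lincomb a vs
  lincomb-cong {d = d} a us≈vs i = sumF-cong d (λ j → *-congˡ (us≈vs j i))

  lincomb-columns : ∀ {m d} (M : Matrix m d) (x : Vector d) → lincomb x (λ j i → M i j) ≈ᵥ (M · x)
  lincomb-columns {d = d} M x i = sumF-cong d (λ j → *-comm (x j) (M i j))

  _∣_ : ∀ {m a b} → Matrix m a → Matrix m b → Matrix m (a ℕ.+ b)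
  (X ∣ Y) i = X i ++ Y i

  ∣-·-++ : ∀ {m a b} (X : Matrix m a) (Y : Matrix m b) u w →
           ((X ∣ Y) · (u ++ w)) ≈ᵥ ((X · u) +ᵥ (Y · w))
  ∣-·-++ {a = a} {b} X Y u w i = trans (sumF-++ a b _) (+-cong (sumF-cong a left) (sumF-cong b right))
    where
      left : ∀ j → (X ∣ Y) i (j ↑ˡ b) * (u ++ w) (j ↑ˡ b) ≈ X i j * u j
      left j = reflexive (≡.cong₂ _*_ (lookup-++ˡ (X i) (Y i) j) (lookup-++ˡ u w j))
      right : ∀ j → (X ∣ Y) i (a ↑ʳ j) * (u ++ w) (a ↑ʳ j) ≈ Y i j * w j
      right j = reflexive (≡.cong₂ _*_ (lookup-++ʳ (X i) (Y i) j) (lookup-++ʳ u w j))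

  unit : ∀ {n} → Fin n → Vector n
  unit k j with j ≟ k
  ... | yes _ = 1#
  ... | no  _ = 0#

  unit-same : ∀ {n} (k : Fin n) → unit k k ≈ 1#
  unit-same k with k ≟ k
  ... | yes _   = refl
  ... | no  k≢k = ⊥-elim (k≢k ≡.refl)

  unit-other : ∀ {n} {k j : Fin n} → j ≢ k → unit k j ≈ 0#
  unit-other {k = k} {j} j≢k with j ≟ k
  ... | yes j≡k = ⊥-elim (j≢k j≡k)
  ... | no  _   = refl

  lincomb-unit : ∀ {n} (x : Vector n) → lincomb x unit ≈ᵥ x
  lincomb-unit {n} x j = begin
    sumF n (λ k → x k * unit k j)
      ≈⟨ sumF-single n _ j (λ k k≢j → trans (*-congˡ (unit-other (k≢j ∘ ≡.sym))) (zeroʳ _)) ⟩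
    x j * unit j j                ≈⟨ *-congˡ (unit-same j) ⟩
    x j * 1#                      ≈⟨ *-identityʳ _ ⟩
    x j                           ∎

  ·-unit : ∀ {m n} (X : Matrix m n) k → (X · unit k) ≈ᵥ (λ i → X i k)
  ·-unit {n = n} X k i = begin
    sumF n (λ j → X i j * unit k j)
      ≈⟨ sumF-single n _ k (λ j j≢k → trans (*-congˡ (unit-other j≢k)) (zeroʳ _)) ⟩
    X i k * unit k k                ≈⟨ *-congˡ (unit-same k) ⟩
    X i k * 1#                      ≈⟨ *-identityʳ _ ⟩
    X i k                           ∎

  _[_]≔_ : ∀ {d m} → Matrix d m → Fin d → Vector m → Matrix d m
  M [ p ]≔ z = updateAt M p (const z)

  ≔-cong : ∀ {d m} (M : Matrix d m) p {z w : Vector m} → z ≈ᵥ w → (M [ p ]≔ z) ≈ₘ (M [ p ]≔ w)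
  ≔-cong M p {z} {w} z≈w i j with i ≟ p
  ... | yes ≡.refl = begin
    (M [ i ]≔ z) i j ≡⟨ ≡.cong-app (updateAt-updates i M) j ⟩
    z j              ≈⟨ z≈w j ⟩
    w j              ≡⟨ ≡.cong-app (updateAt-updates i M) j ⟨
    (M [ i ]≔ w) i j ∎
  ... | no i≢p = ≡⇒≈ᵥ (≡.trans (updateAt-minimal i p M i≢p) (≡.sym (updateAt-minimal i p M i≢p))) j

  module _ {d m} (M : Matrix d m) {p q : Fin d} (p≢q : p ≢ q) (u v : Vector m) where

    ≔-≔-at₁ : ((M [ p ]≔ u) [ q ]≔ v) p ≡ u
    ≔-≔-at₁ = ≡.trans (updateAt-minimal p q _ p≢q) (updateAt-updates p M)

    ≔-≔-at₂ : ((M [ p ]≔ u) [ q ]≔ v) q ≡ v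
    ≔-≔-at₂ = updateAt-updates q _

    ≔-≔-elsewhere : ∀ {i} → i ≢ p → i ≢ q → ((M [ p ]≔ u) [ q ]≔ v) i ≡ M i
    ≔-≔-elsewhere i≢p i≢q = ≡.trans (updateAt-minimal _ q _ i≢q) (updateAt-minimal _ p M i≢p)

  swapRows : ∀ {d m} → Matrix d m → Fin d → Fin d → Matrix d m
  swapRows M p q = (M [ p ]≔ M q) [ q ]≔ M p

  sgn : ∀ {n} → Fin n → Carrier
  sgn zero    = 1#
  sgn (suc i) = - sgn i

  sgn-squared : ∀ {n} (p : Fin n) → sgn p * sgn p ≈ 1#
  sgn-squared zero    = *-identityˡ 1#
  sgn-squared (suc p) = begin
    - sgn p * - sgn p     ≈⟨ -‿distribˡ-* _ _ ⟨
    - (sgn p * - sgn p)   ≈⟨ -‿cong (-‿distribʳ-* _ _) ⟨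
    - - (sgn p * sgn p)   ≈⟨ ⁻¹-involutive _ ⟩
    sgn p * sgn p         ≈⟨ sgn-squared p ⟩
    1#                    ∎

  sgn-adjacent : ∀ {n} {p q : Fin n} → Adjacent p q → sgn q ≈ - sgn p
  sgn-adjacent {p = zero}  {suc zero}    adj = refl
  sgn-adjacent {p = zero}  {suc (suc q)} ()
  sgn-adjacent {p = suc p} {zero}        ()
  sgn-adjacent {p = suc p} {suc q}       adj = -‿cong (sgn-adjacent (ℕₚ.suc-injective adj))

  minor : ∀ {d} → Fin (suc d) → Matrix (suc d) (suc d) → Matrix d d
  minor i M a b = M (punchIn i a) (suc b)

  det : ∀ {d} → Matrix d d → Carrier
  det {zero}  M = 1#
  det {suc d} M = sumF (suc d) (λ i → sgn i * (M i zero * det (minor i M)))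

  det-cong : ∀ {d} {M N : Matrix d d} → M ≈ₘ N → det M ≈ det N
  det-cong {zero}  M≈N = refl
  det-cong {suc d} M≈N = sumF-cong (suc d) λ i →
    *-congˡ {sgn i} (*-cong (M≈N i zero) (det-cong (λ a b → M≈N (punchIn i a) (suc b))))

  minor-≔-same : ∀ {d} (M : Matrix (suc d) (suc d)) p z → minor p (M [ p ]≔ z) ≈ₘ minor p M
  minor-≔-same M p z a = ≡⇒≈ᵥ (updateAt-minimal (punchIn p a) p M (punchInᵢ≢i p a)) ∘ suc

  minor-≔-other : ∀ {d} (M : Matrix (suc d) (suc d)) {i p} (i≢p : i ≢ p) z →
                  minor i (M [ p ]≔ z) ≈ₘ (minor i M [ punchOut i≢p ]≔ (z ∘ suc))
  minor-≔-other M {i} {p} i≢p z a b with a ≟ punchOut i≢p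
  ... | yes ≡.refl = begin
    (M [ p ]≔ z) (punchIn i a) (suc b) ≡⟨ ≡.cong (λ r → (M [ p ]≔ z) r (suc b)) (punchIn-punchOut i≢p) ⟩
    (M [ p ]≔ z) p (suc b)             ≡⟨ ≡.cong-app (updateAt-updates p M) (suc b) ⟩
    z (suc b)                          ≡⟨ ≡.cong-app (updateAt-updates a (minor i M)) b ⟨
    (minor i M [ a ]≔ (z ∘ suc)) a b   ∎
  ... | no a≢ = begin
    (M [ p ]≔ z) (punchIn i a) (suc b) ≡⟨ ≡.cong-app (updateAt-minimal (punchIn i a) p M punchIn≢p) (suc b) ⟩
    M (punchIn i a) (suc b)            ≡⟨ ≡.cong-app (updateAt-minimal a _ (minor i M) a≢) b ⟨
    (minor i M [ _ ]≔ (z ∘ suc)) a b   ∎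
    where
      punchIn≢p : punchIn i a ≢ p
      punchIn≢p eq = a≢ (punchIn-injective i a _ (≡.trans eq (≡.sym (punchIn-punchOut i≢p))))

  det-linear : ∀ {d} (M : Matrix d d) p a (x y : Vector d) →
               det (M [ p ]≔ (λ j → a * x j + y j)) ≈ a * det (M [ p ]≔ x) + det (M [ p ]≔ y)
  det-linear {suc d} M p a x y = begin
    sumF (suc d) (λ i → term i (λ j → a * x j + y j))
      ≈⟨ sumF-cong (suc d) term-linear ⟩
    sumF (suc d) (λ i → a * term i x + term i y)
      ≈⟨ sumF-distrib-+ (suc d) (λ i → a * term i x) (λ i → term i y) ⟩
    sumF (suc d) (λ i → a * term i x) + sumF (suc d) (λ i → term i y)
      ≈⟨ +-congʳ (sym (*-distribˡ-sumF (suc d) a (λ i → term i x))) ⟩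
    a * sumF (suc d) (λ i → term i x) + sumF (suc d) (λ i → term i y) ∎
    where
      term : Fin (suc d) → Vector (suc d) → Carrier
      term i w = sgn i * ((M [ p ]≔ w) i zero * det (minor i (M [ p ]≔ w)))

      term-same : ∀ w → term p w ≈ sgn p * (w zero * det (minor p M))
      term-same w = *-congˡ (*-cong (≡⇒≈ᵥ (updateAt-updates p M) zero) (det-cong (minor-≔-same M p w)))

      term-other : ∀ {i} (i≢p : i ≢ p) w →
                   term i w ≈ sgn i * (M i zero * det (minor i M [ punchOut i≢p ]≔ (w ∘ suc)))
      term-other {i} i≢p w =
        *-congˡ (*-cong (≡⇒≈ᵥ (updateAt-minimal i p M i≢p) zero) (det-cong (minor-≔-other M i≢p w)))

      term-linear : ∀ i → term i (λ j → a * x j + y j) ≈ a * term i x + term i y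
      term-linear i with i ≟ p
      ... | yes ≡.refl = begin
        term i _                                          ≈⟨ term-same _ ⟩
        sgn i * ((a * x zero + y zero) * D)
          ≈⟨ solve 5 (λ s a x y D → s :* ((a :* x :+ y) :* D) := a :* (s :* (x :* D)) :+ s :* (y :* D))
                     refl (sgn i) a (x zero) (y zero) D ⟩
        a * (sgn i * (x zero * D)) + sgn i * (y zero * D) ≈⟨ +-cong (*-congˡ (term-same x)) (term-same y) ⟨
        a * term i x + term i y                           ∎
        where D = det (minor i M)
      ... | no i≢p = begin
        term i _                                ≈⟨ term-other i≢p _ ⟩
        sgn i * (M i zero * det (N [ q ]≔ _))   ≈⟨ *-congˡ (*-congˡ (det-linear N q a (x ∘ suc) (y ∘ suc))) ⟩
        sgn i * (M i zero * (a * Dx + Dy))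
          ≈⟨ solve 5 (λ s m a X Y → s :* (m :* (a :* X :+ Y)) := a :* (s :* (m :* X)) :+ s :* (m :* Y))
                     refl (sgn i) (M i zero) a Dx Dy ⟩
        a * (sgn i * (M i zero * Dx)) + sgn i * (M i zero * Dy)
          ≈⟨ +-cong (*-congˡ (term-other i≢p x)) (term-other i≢p y) ⟨
        a * term i x + term i y                 ∎
        where
          N = minor i M
          q = punchOut i≢p
          Dx = det (N [ q ]≔ (x ∘ suc))
          Dy = det (N [ q ]≔ (y ∘ suc))

  det-+-row : ∀ {d} (M : Matrix d d) p (x y : Vector d) →
              det (M [ p ]≔ (x +ᵥ y)) ≈ det (M [ p ]≔ x) + det (M [ p ]≔ y)
  det-+-row M p x y = begin
    det (M [ p ]≔ (x +ᵥ y))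
      ≈⟨ det-cong (≔-cong M p (λ j → +-congʳ (sym (*-identityˡ (x j))))) ⟩
    det (M [ p ]≔ (λ j → 1# * x j + y j))     ≈⟨ det-linear M p 1# x y ⟩
    1# * det (M [ p ]≔ x) + det (M [ p ]≔ y) ≈⟨ +-congʳ (*-identityˡ _) ⟩
    det (M [ p ]≔ x) + det (M [ p ]≔ y)      ∎

  det-zero-row : ∀ {d} (M : Matrix d d) p → det (M [ p ]≔ 0ᵥ) ≈ 0#
  det-zero-row M p = x+x≈x⇒x≈0 _ (sym (trans (det-cong (≔-cong M p (λ _ → sym (+-identityˡ 0#))))
                                              (det-+-row M p 0ᵥ 0ᵥ)))

  det-lincomb-row : ∀ {d m} (M : Matrix d d) p (a : Fin m → Carrier) (vs : Fin m → Vector d) →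
                    det (M [ p ]≔ lincomb a vs) ≈ sumF m (λ k → a k * det (M [ p ]≔ vs k))
  det-lincomb-row {m = zero}  M p a vs = det-zero-row M p
  det-lincomb-row {m = suc m} M p a vs =
    trans (det-linear M p (a zero) (vs zero) _) (+-congˡ (det-lincomb-row M p (a ∘ suc) (vs ∘ suc)))

  minor-adjacent : ∀ {d} (M : Matrix (suc d) (suc d)) {p q} → Adjacent p q → M p ≈ᵥ M q →
                   minor p M ≈ₘ minor q M
  minor-adjacent M {p} {q} adj Mp≈Mq a b with adjacent-punchIn adj a
  ... | inj₁ eq          = reflexive (≡.cong (λ r → M r (suc b)) eq)
  ... | inj₂ (eq₁ , eq₂) = begin
    M (punchIn p a) (suc b) ≡⟨ ≡.cong (λ r → M r (suc b)) eq₁ ⟩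
    M q (suc b)             ≈⟨ Mp≈Mq (suc b) ⟨
    M p (suc b)             ≡⟨ ≡.cong (λ r → M r (suc b)) eq₂ ⟨
    M (punchIn q a) (suc b) ∎

  det-adjacent-equal : ∀ {d} (M : Matrix d d) {p q} → Adjacent p q → M p ≈ᵥ M q → det M ≈ 0#
  det-adjacent-equal {suc d} M {p} {q} adj Mp≈Mq = begin
    sumF (suc d) term                                   ≈⟨ sumF-pair (suc d) term p q (adjacent⇒≢ adj) term≈0 ⟩
    term p + term q
      ≈⟨ +-congˡ (*-cong (sgn-adjacent adj) (*-cong (sym (Mp≈Mq zero))
                                                    (det-cong (sym ∘₂ minor-adjacent M adj Mp≈Mq)))) ⟩
    sgn p * (M p zero * D) + - sgn p * (M p zero * D)   ≈⟨ +-congˡ (-‿distribˡ-* _ _) ⟨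
    sgn p * (M p zero * D) + - (sgn p * (M p zero * D)) ≈⟨ -‿inverseʳ _ ⟩
    0#                                                  ∎
    where
      D = det (minor p M)

      term : Fin (suc d) → Carrier
      term i = sgn i * (M i zero * det (minor i M))

      term≈0 : ∀ i → i ≢ p → i ≢ q → term i ≈ 0#
      term≈0 i i≢p i≢q = begin
        sgn i * (M i zero * det (minor i M))
          ≈⟨ *-congˡ (*-congˡ (det-adjacent-equal (minor i M) (adjacent-punchOut i≢p i≢q adj) same-rows)) ⟩
        sgn i * (M i zero * 0#) ≈⟨ trans (*-congˡ (zeroʳ _)) (zeroʳ _) ⟩
        0#                      ∎
        where
          same-rows : minor i M (punchOut i≢p) ≈ᵥ minor i M (punchOut i≢q)
          same-rows b = begin
            M (punchIn i (punchOut i≢p)) (suc b) ≡⟨ ≡.cong (λ r → M r (suc b)) (punchIn-punchOut i≢p) ⟩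
            M p (suc b)                          ≈⟨ Mp≈Mq (suc b) ⟩
            M q (suc b)                          ≡⟨ ≡.cong (λ r → M r (suc b)) (punchIn-punchOut i≢q) ⟨
            M (punchIn i (punchOut i≢q)) (suc b) ∎

  -- Expand det (R s s) = 0 with s = M p + M q by linearity in both rows.
  det-swapRows-adjacent : ∀ {d} (M : Matrix d d) {p q} → Adjacent p q → det (swapRows M p q) ≈ - det M
  det-swapRows-adjacent {d} M {p} {q} adj = inverseʳ-unique (det M) (det (R (M q) (M p))) (begin
    det M + det (R (M q) (M p))
      ≈⟨ +-cong (sym (+-identityˡ _)) (sym (+-identityʳ _)) ⟩
    (0# + det M) + (det (R (M q) (M p)) + 0#)
      ≈⟨ +-cong (+-cong (sym (det-R-diagonal (M p))) (sym (det-cong R-Mp-Mq)))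
                (+-congˡ (sym (det-R-diagonal (M q)))) ⟩
    (det (R (M p) (M p)) + det (R (M p) (M q))) + (det (R (M q) (M p)) + det (R (M q) (M q)))
      ≈⟨ +-cong (det-R-linearʳ (M p) (M p) (M q)) (det-R-linearʳ (M q) (M p) (M q)) ⟨
    det (R (M p) s) + det (R (M q) s)
      ≈⟨ det-R-linearˡ (M p) (M q) s ⟨
    det (R s s)
      ≈⟨ det-R-diagonal s ⟩
    0# ∎)
    where
      p≢q = adjacent⇒≢ adj
      s = M p +ᵥ M q

      R : Vector d → Vector d → Matrix d d
      R u v = (M [ p ]≔ u) [ q ]≔ v

      R-commutes : ∀ u v → R u v ≈ₘ ((M [ q ]≔ v) [ p ]≔ u)
      R-commutes u v i = ≡⇒≈ᵥ (updateAt-commutes q p (p≢q ∘ ≡.sym) M i)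

      det-R-linearʳ : ∀ u v v′ → det (R u (v +ᵥ v′)) ≈ det (R u v) + det (R u v′)
      det-R-linearʳ u = det-+-row (M [ p ]≔ u) q

      det-R-linearˡ : ∀ u u′ v → det (R (u +ᵥ u′) v) ≈ det (R u v) + det (R u′ v)
      det-R-linearˡ u u′ v = begin
        det (R (u +ᵥ u′) v)                 ≈⟨ det-cong (R-commutes (u +ᵥ u′) v) ⟩
        det ((M [ q ]≔ v) [ p ]≔ (u +ᵥ u′)) ≈⟨ det-+-row (M [ q ]≔ v) p u u′ ⟩
        det ((M [ q ]≔ v) [ p ]≔ u) + det ((M [ q ]≔ v) [ p ]≔ u′)
          ≈⟨ +-cong (det-cong (R-commutes u v)) (det-cong (R-commutes u′ v)) ⟨
        det (R u v) + det (R u′ v)          ∎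

      det-R-diagonal : ∀ u → det (R u u) ≈ 0#
      det-R-diagonal u =
        det-adjacent-equal (R u u) adj
          (≡⇒≈ᵥ (≡.trans (≔-≔-at₁ M p≢q u u) (≡.sym (≔-≔-at₂ M p≢q u u))))

      R-Mp-Mq : R (M p) (M q) ≈ₘ M
      R-Mp-Mq i with i ≟ p | i ≟ q
      ... | yes ≡.refl | _          = ≡⇒≈ᵥ (≔-≔-at₁ M p≢q (M p) (M q))
      ... | no _       | yes ≡.refl = ≡⇒≈ᵥ (≔-≔-at₂ M p≢q (M p) (M q))
      ... | no i≢p     | no i≢q     = ≡⇒≈ᵥ (≔-≔-elsewhere M p≢q (M p) (M q) i≢p i≢q)

  -- Swapping the adjacent rows q₋ and q moves the repeated row one step closer to row p.
  det-equal-rows-apart : ∀ k {d} (M : Matrix d d) {p q} → suc (toℕ p ℕ.+ k) ≡ toℕ q → M p ≈ᵥ M q →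
                         det M ≈ 0#
  det-equal-rows-apart zero    M {p} dist Mp≈Mq =
    det-adjacent-equal M (≡.trans (≡.sym dist) (≡.cong suc (ℕₚ.+-identityʳ (toℕ p)))) Mp≈Mq
  det-equal-rows-apart (suc k) M {p} {suc q} dist Mp≈Mq = begin
    det M     ≈⟨ ⁻¹-involutive (det M) ⟨
    - - det M ≈⟨ -‿cong (det-swapRows-adjacent M adj) ⟨
    - det M′  ≈⟨ -‿cong (det-equal-rows-apart k M′ dist′ M′p≈M′q₋) ⟩
    - 0#      ≈⟨ ε⁻¹≈ε ⟩
    0#        ∎
    where
      q₋ = inject₁ q
      M′ = swapRows M q₋ (suc q)

      adj : Adjacent q₋ (suc q)
      adj = ≡.cong suc (≡.sym (toℕ-inject₁ q))

      dist′ : suc (toℕ p ℕ.+ k) ≡ toℕ q₋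
      dist′ = ≡.trans (≡.sym (ℕₚ.+-suc (toℕ p) k))
                      (≡.trans (ℕₚ.suc-injective dist) (≡.sym (toℕ-inject₁ q)))

      p≢q₋ : p ≢ q₋
      p≢q₋ p≡q₋ = ℕₚ.m≢1+m+n (toℕ p) (≡.trans (≡.cong toℕ p≡q₋) (≡.sym dist′))

      p≢q : p ≢ suc q
      p≢q p≡q = ℕₚ.m≢1+m+n (toℕ p) (≡.trans (≡.cong toℕ p≡q) (≡.sym dist))

      M′p≈M′q₋ : M′ p ≈ᵥ M′ q₋
      M′p≈M′q₋ j = begin
        M′ p j      ≡⟨ ≡.cong-app (≔-≔-elsewhere M (adjacent⇒≢ adj) _ _ p≢q₋ p≢q) j ⟩
        M p j       ≈⟨ Mp≈Mq j ⟩
        M (suc q) j ≡⟨ ≡.cong-app (≔-≔-at₁ M (adjacent⇒≢ adj) _ _) j ⟨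
        M′ q₋ j     ∎

  det-equal-rows : ∀ {d} (M : Matrix d d) {p q} → p ≢ q → M p ≈ᵥ M q → det M ≈ 0#
  det-equal-rows M {p} {q} p≢q Mp≈Mq with ℕₚ.<-cmp (toℕ p) (toℕ q)
  ... | tri< p<q _ _ = det-equal-rows-apart _ M (proj₂ (ℕₚ.m≤n⇒∃[o]m+o≡n p<q)) Mp≈Mq
  ... | tri≈ _ p≡q _ = ⊥-elim (p≢q (toℕ-injective p≡q))
  ... | tri> _ _ q<p = det-equal-rows-apart _ M (proj₂ (ℕₚ.m≤n⇒∃[o]m+o≡n q<p)) (sym ∘ Mp≈Mq)

  adjugate : ∀ {d} → Matrix d d → Matrix d d
  adjugate M k p = det (M [ p ]≔ unit k)

  *ₘ-adjugate : ∀ {d} (M : Matrix d d) q p → (M *ₘ adjugate M) q p ≈ det (M [ p ]≔ M q)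
  *ₘ-adjugate M q p = trans (sym (det-lincomb-row M p (M q) unit)) (det-cong (≔-cong M p (lincomb-unit (M q))))

  *ₘ-adjugate-same : ∀ {d} (M : Matrix d d) p → (M *ₘ adjugate M) p p ≈ det M
  *ₘ-adjugate-same M p = trans (*ₘ-adjugate M p p) (det-cong (≡⇒≈ᵥ ∘ updateAt-id-local p M ≡.refl))

  *ₘ-adjugate-other : ∀ {d} (M : Matrix d d) {q p} → q ≢ p → (M *ₘ adjugate M) q p ≈ 0#
  *ₘ-adjugate-other M {q} {p} q≢p = trans (*ₘ-adjugate M q p) (det-equal-rows (M [ p ]≔ M q) (q≢p ∘ ≡.sym)
    (≡⇒≈ᵥ (≡.trans (updateAt-updates p M) (≡.sym (updateAt-minimal q p M q≢p)))))

  ·-adjugate : ∀ {d} (M : Matrix d d) y → (M · (adjugate M · y)) ≈ᵥ (λ q → det M * y q)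
  ·-adjugate {d} M y q = begin
    (M · (adjugate M · y)) q                   ≈⟨ *ₘ-· M (adjugate M) y q ⟨
    sumF d (λ p → (M *ₘ adjugate M) q p * y p)
      ≈⟨ sumF-single d _ q (λ p p≢q → trans (*-congʳ (*ₘ-adjugate-other M (p≢q ∘ ≡.sym))) (zeroˡ _)) ⟩
    (M *ₘ adjugate M) q q * y q                ≈⟨ *-congʳ (*ₘ-adjugate-same M q) ⟩
    det M * y q                                ∎

  adjugate-zero : ∀ {d} (M : Matrix (suc d) (suc d)) p → adjugate M zero p ≈ sgn p * det (minor p M)
  adjugate-zero {d} M p = begin
    sumF (suc d) term                ≈⟨ sumF-single (suc d) term p term-other ⟩
    term p                           ≈⟨ *-congˡ (*-cong M′pzero≈1 (det-cong (minor-≔-same M p (unit zero)))) ⟩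
    sgn p * (1# * det (minor p M))   ≈⟨ *-congˡ (*-identityˡ _) ⟩
    sgn p * det (minor p M)          ∎
    where
      M′ = M [ p ]≔ unit zero

      term : Fin (suc d) → Carrier
      term i = sgn i * (M′ i zero * det (minor i M′))

      M′pzero≈1 : M′ p zero ≈ 1#
      M′pzero≈1 = trans (≡⇒≈ᵥ (updateAt-updates p M) zero) (unit-same {suc d} zero)

      unit₀∘suc≈0 : (unit zero ∘ suc) ≈ᵥ 0ᵥ
      unit₀∘suc≈0 b = unit-other {k = zero} {suc b} λ ()

      term-other : ∀ i → i ≢ p → term i ≈ 0#
      term-other i i≢p = begin
        sgn i * (M′ i zero * det (minor i M′))
          ≈⟨ *-congˡ (*-congˡ (det-cong (minor-≔-other M i≢p (unit zero)))) ⟩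
        sgn i * (M′ i zero * det (minor i M [ punchOut i≢p ]≔ (unit zero ∘ suc)))
          ≈⟨ *-congˡ (*-congˡ (det-cong (≔-cong (minor i M) (punchOut i≢p) unit₀∘suc≈0))) ⟩
        sgn i * (M′ i zero * det (minor i M [ punchOut i≢p ]≔ 0ᵥ))
          ≈⟨ *-congˡ (*-congˡ (det-zero-row (minor i M) (punchOut i≢p))) ⟩
        sgn i * (M′ i zero * 0#)
          ≈⟨ trans (*-congˡ (zeroʳ _)) (zeroʳ _) ⟩
        0# ∎

  NontrivialKernel : ∀ {m n} → Matrix m n → Set (c ⊔ ℓ)
  NontrivialKernel {n = n} X = Σ (Vector n) λ x → (X · x) ≈ᵥ 0ᵥ × Σ (Fin n) λ i → ¬ (x i ≈ 0#)

  -- With x_p a kernel vector of minor p M, M maps y_p = (0, x_p) to t_p e_p, and t_p ≉ 0 unless y_p is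
  -- itself a kernel vector of M; then e_0 − Σ_p (M_{p0} / t_p) y_p is a kernel vector with first entry 1.
  minor-kernels⇒¬¬kernel : ∀ {d} (M : Matrix (suc d) (suc d)) →
                           (∀ p → NontrivialKernel (minor p M)) → ¬ ¬ NontrivialKernel M
  minor-kernels⇒¬¬kernel {d} M kernel noKernel =
    noKernel (z , Mz≈0 , zero , λ z₀≈0 → 1≉0 (trans (sym z₀≈1) z₀≈0))
    where
      y : Fin (suc d) → Vector (suc d)
      y p = 0# ∷ proj₁ (kernel p)

      My≈0-elsewhere : ∀ {p q} → q ≢ p → (M · y p) q ≈ 0#
      My≈0-elsewhere {p} {q} q≢p = begin
        M q zero * 0# + sumF d (λ b → M q (suc b) * y p (suc b))
          ≈⟨ +-cong (zeroʳ _) (sumF-cong d (λ b →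
               reflexive (≡.cong (λ r → M r (suc b) * y p (suc b)) (≡.sym (punchIn-punchOut p≢q))))) ⟩
        0# + (minor p M · proj₁ (kernel p)) (punchOut p≢q) ≈⟨ +-identityˡ _ ⟩
        (minor p M · proj₁ (kernel p)) (punchOut p≢q)      ≈⟨ proj₁ (proj₂ (kernel p)) _ ⟩
        0#                                                 ∎
        where p≢q = q≢p ∘ ≡.sym

      t : Fin (suc d) → Carrier
      t p = (M · y p) p

      t≉0 : ∀ p → ¬ (t p ≈ 0#)
      t≉0 p tₚ≈0 = noKernel (y p , My≈0 , suc (proj₁ nonzero) , proj₂ nonzero)
        where
          nonzero = proj₂ (proj₂ (kernel p))
          My≈0 : (M · y p) ≈ᵥ 0ᵥ
          My≈0 q with q ≟ p
          ... | yes ≡.refl = tₚ≈0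
          ... | no q≢p     = My≈0-elsewhere q≢p

      t⁻¹ : Fin (suc d) → Carrier
      t⁻¹ p = proj₁ (inverse (t p) (t≉0 p))

      coefficient : Fin (suc d) → Carrier
      coefficient p = M p zero * t⁻¹ p

      M-lincomb-y : ∀ q → (M · lincomb coefficient y) q ≈ M q zero
      M-lincomb-y q = begin
        (M · lincomb coefficient y) q                    ≈⟨ ·-lincomb M coefficient y q ⟩
        sumF (suc d) (λ p → coefficient p * (M · y p) q)
          ≈⟨ sumF-single (suc d) _ q (λ p p≢q →
               trans (*-congˡ (My≈0-elsewhere (p≢q ∘ ≡.sym))) (zeroʳ (coefficient p))) ⟩
        M q zero * t⁻¹ q * t q                           ≈⟨ *-assoc _ _ _ ⟩
        M q zero * (t⁻¹ q * t q)
          ≈⟨ *-congˡ (trans (*-comm (t⁻¹ q) (t q)) (proj₂ (inverse (t q) (t≉0 q)))) ⟩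
        M q zero * 1#                                    ≈⟨ *-identityʳ _ ⟩
        M q zero                                         ∎

      z : Vector (suc d)
      z = unit zero +ᵥ (-ᵥ lincomb coefficient y)

      Mz≈0 : (M · z) ≈ᵥ 0ᵥ
      Mz≈0 q = begin
        (M · z) q                                ≈⟨ ·-distrib-+ M (unit zero) (-ᵥ lincomb coefficient y) q ⟩
        (M · unit zero) q + (M · (-ᵥ lincomb coefficient y)) q
          ≈⟨ +-cong (·-unit M zero q) (·-neg M (lincomb coefficient y) q) ⟩
        M q zero - (M · lincomb coefficient y) q ≈⟨ +-congˡ (-‿cong (M-lincomb-y q)) ⟩
        M q zero - M q zero                      ≈⟨ -‿inverseʳ _ ⟩
        0#                                       ∎

      z₀≈1 : z zero ≈ 1#
      z₀≈1 = begin
        unit {suc d} zero zero - sumF (suc d) (λ p → coefficient p * 0#)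
          ≈⟨ +-cong (unit-same {suc d} zero) (-‿cong (sumF-zero (suc d) (λ p → zeroʳ (coefficient p)))) ⟩
        1# - 0#  ≈⟨ +-congˡ ε⁻¹≈ε ⟩
        1# + 0#  ≈⟨ +-identityʳ 1# ⟩
        1#       ∎

  -- Equality in K is not decidable, so a singular matrix only has a kernel vector up to double negation.
  -- The columns of the adjugate of a singular M lie in its kernel, and their first entries are the signed
  -- minors along the first column; so these minors are (doubly negated) singular, and induction applies.
  det≈0⇒¬¬kernel : ∀ {d} (M : Matrix d d) → det M ≈ 0# → ¬ ¬ NontrivialKernel M
  det≈0⇒¬¬kernel {zero}  M 1≈0   _        = 1≉0 1≈0
  det≈0⇒¬¬kernel {suc d} M det≈0 noKernel =
    sequence (RawMonad.rawApplicative ¬¬-Monad) ¬¬minor-kernel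
             (λ kernels → minor-kernels⇒¬¬kernel M kernels noKernel)
    where
      adjugate-column-kernel : ∀ p → (M · (λ k → adjugate M k p)) ≈ᵥ 0ᵥ
      adjugate-column-kernel p q with q ≟ p
      ... | yes ≡.refl = trans (*ₘ-adjugate-same M q) det≈0
      ... | no q≢p     = *ₘ-adjugate-other M q≢p

      ¬¬det-minor≈0 : ∀ p → ¬ ¬ (det (minor p M) ≈ 0#)
      ¬¬det-minor≈0 p det≉0 = noKernel ((λ k → adjugate M k p) , adjugate-column-kernel p , zero , λ adj≈0 →
        det≉0 (begin
          det (minor p M)                   ≈⟨ *-identityˡ _ ⟨
          1# * det (minor p M)              ≈⟨ *-congʳ (sgn-squared p) ⟨
          sgn p * sgn p * det (minor p M)   ≈⟨ *-assoc (sgn p) (sgn p) (det (minor p M)) ⟩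
          sgn p * (sgn p * det (minor p M)) ≈⟨ *-congˡ (trans (sym (adjugate-zero M p)) adj≈0) ⟩
          sgn p * 0#                        ≈⟨ zeroʳ _ ⟩
          0#                                ∎))

      ¬¬minor-kernel : ∀ p → ¬ ¬ NontrivialKernel (minor p M)
      ¬¬minor-kernel p noMinorKernel =
        ¬¬det-minor≈0 p (λ det≈0′ → det≈0⇒¬¬kernel (minor p M) det≈0′ noMinorKernel)

  Injective : ∀ {m n} → Matrix m n → Set (c ⊔ ℓ)
  Injective {n = n} X = ∀ x → (X · x) ≈ᵥ 0ᵥ → x ≈ᵥ (0ᵥ {n})

  injective⇒rightInverse : ∀ {d} (M : Matrix d d) → Injective M →
                           Σ (Vector d → Vector d) λ N → ∀ y → (M · N y) ≈ᵥ y
  injective⇒rightInverse M injective = N , M·N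
    where
      det≉0 : ¬ (det M ≈ 0#)
      det≉0 det≈0 = det≈0⇒¬¬kernel M det≈0 λ (x , Mx≈0 , i , xᵢ≉0) → xᵢ≉0 (injective x Mx≈0 i)

      det⁻¹ = proj₁ (inverse (det M) det≉0)

      N : Vector _ → Vector _
      N y = adjugate M · (λ p → det⁻¹ * y p)

      M·N : ∀ y → (M · N y) ≈ᵥ y
      M·N y q = begin
        (M · N y) q           ≈⟨ ·-adjugate M _ q ⟩
        det M * (det⁻¹ * y q) ≈⟨ *-assoc _ _ _ ⟨
        det M * det⁻¹ * y q   ≈⟨ *-congʳ (proj₂ (inverse (det M) det≉0)) ⟩
        1# * y q              ≈⟨ *-identityˡ _ ⟩
        y q                   ∎

  _⊆_ : ∀ {m} → Subset m → Subset m → Set (c ⊔ ℓ)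
  U ⊆ W = ∀ v → U v → W v

  Span : ∀ {m d} → (Fin d → Vector m) → Subset m
  Span {d = d} vs v = Σ (Fin d → Carrier) λ a → lincomb a vs ≈ᵥ v

  independent-⊆-Im : ∀ {m d} (W : Matrix m d) {vs : Fin d → Vector m} → LinIndep vs → (∀ j → Im W (vs j)) →
                     Injective W × (∀ y → Span vs (W · y))
  independent-⊆-Im {d = d} W {vs} independent vs∈ImW = W-injective , W·y∈Span
    where
      M : Matrix d d
      M i j = proj₁ (vs∈ImW j) i

      lincomb≈W·M· : ∀ x → lincomb x vs ≈ᵥ (W · (M · x))
      lincomb≈W·M· x i = begin
        lincomb x vs i                        ≈⟨ lincomb-cong x (λ j → sym ∘ proj₂ (vs∈ImW j)) i ⟩
        lincomb x (λ j → W · (λ i → M i j)) i ≈⟨ ·-lincomb W x (λ j i → M i j) i ⟨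
        (W · lincomb x (λ j i → M i j)) i     ≈⟨ ·-cong W (lincomb-columns M x) i ⟩
        (W · (M · x)) i                       ∎

      M-injective : Injective M
      M-injective x Mx≈0 = independent x (λ i → trans (lincomb≈W·M· x i) (·-zeroʳ W Mx≈0 i))

      N = proj₁ (injective⇒rightInverse M M-injective)
      M·N = proj₂ (injective⇒rightInverse M M-injective)

      W·y∈Span : ∀ y → Span vs (W · y)
      W·y∈Span y = N y , λ i → trans (lincomb≈W·M· (N y) i) (·-cong W (M·N y) i)

      W-injective : Injective W
      W-injective y Wy≈0 i = trans (sym (M·N y i)) (·-zeroʳ M Ny≈0 i)
        where
          Ny≈0 : N y ≈ᵥ 0ᵥ
          Ny≈0 = independent (N y) (λ i → trans (proj₂ (W·y∈Span y) i) (Wy≈0 i))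

  HasDim-⊆-Im⇒Injective : ∀ {m d} {U : Subset m} (W : Matrix m d) → HasDim U d → U ⊆ Im W → Injective W
  HasDim-⊆-Im⇒Injective W (vs , vs∈U , independent , _) U⊆ImW =
    proj₁ (independent-⊆-Im W independent (λ j → U⊆ImW _ (vs∈U j)))

  HasDim-⊆-Im⇒⊇ : ∀ {m n d} (P : Matrix m n) (W : Matrix m d) → HasDim (Im P) d → Im P ⊆ Im W → Im W ⊆ Im P
  HasDim-⊆-Im⇒⊇ P W (vs , vs∈ImP , independent , _) ImP⊆ImW v (y , Wy≈v) = lincomb a xs , λ i → begin
    (P · lincomb a xs) i         ≈⟨ ·-lincomb P a xs i ⟩
    lincomb a (λ j → P · xs j) i ≈⟨ lincomb-cong a (λ j → proj₂ (vs∈ImP j)) i ⟩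
    lincomb a vs i               ≈⟨ a-spans i ⟩
    (W · y) i                    ≈⟨ Wy≈v i ⟩
    v i                          ∎
    where
      xs = λ j → proj₁ (vs∈ImP j)
      W·y∈Span = proj₂ (independent-⊆-Im W independent (λ j → ImP⊆ImW _ (vs∈ImP j))) y
      a = proj₁ W·y∈Span
      a-spans = proj₂ W·y∈Span

  module _ {n s} (A : Matrix n n) (B : Matrix n s) (C : Matrix s n) (D : Matrix s s) where

    block-↑ˡ-↑ˡ : ∀ a b → block A B C D (a ↑ˡ s) (b ↑ˡ s) ≡ A a b
    block-↑ˡ-↑ˡ a b rewrite splitAt-↑ˡ n a s | splitAt-↑ˡ n b s = ≡.refl

    block-↑ˡ-↑ʳ : ∀ a b → block A B C D (a ↑ˡ s) (n ↑ʳ b) ≡ B a b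
    block-↑ˡ-↑ʳ a b rewrite splitAt-↑ˡ n a s | splitAt-↑ʳ n s b = ≡.refl

    block-↑ʳ-↑ˡ : ∀ a b → block A B C D (n ↑ʳ a) (b ↑ˡ s) ≡ C a b
    block-↑ʳ-↑ˡ a b rewrite splitAt-↑ʳ n s a | splitAt-↑ˡ n b s = ≡.refl

  block-*ₘ-↑ˡ-↑ˡ : ∀ {n s} (A A′ : Matrix n n) (B B′ : Matrix n s)
                   (C C′ : Matrix s n) (D D′ : Matrix s s) a b →
                   (block A B C D *ₘ block A′ B′ C′ D′) (a ↑ˡ s) (b ↑ˡ s) ≈ (A *ₘ A′) a b + (B *ₘ C′) a b
  block-*ₘ-↑ˡ-↑ˡ {n} {s} A A′ B B′ C C′ D D′ a b = trans (sumF-++ n s _) (+-cong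
    (sumF-cong n (λ j → reflexive (≡.cong₂ _*_ (block-↑ˡ-↑ˡ A B C D a j) (block-↑ˡ-↑ˡ A′ B′ C′ D′ j b))))
    (sumF-cong s (λ j → reflexive (≡.cong₂ _*_ (block-↑ˡ-↑ʳ A B C D a j) (block-↑ʳ-↑ˡ A′ B′ C′ D′ j b)))))

  module CommutingExtensionProperties
      {n s p} (A : Fin p → Matrix n n) (B : Fin p → Matrix n s) (C : Fin p → Matrix s n) (D : Fin p → Matrix s s)
      (commuting : CommutingExtension A B C D) (k : Fin p) where

    Z : Fin p → Matrix (n ℕ.+ s) (n ℕ.+ s)
    Z i = block (A i) (B i) (C i) (D i)

    commutator≈ : ∀ l → [ A k , A l ] ≈ₘ ((B l *ₘ C k) -ₘ (B k *ₘ C l))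
    commutator≈ l a b = x+y≈z+w⇒x-z≈w-y (begin
      (A k *ₘ A l) a b + (B k *ₘ C l) a b
        ≈⟨ block-*ₘ-↑ˡ-↑ˡ (A k) (A l) (B k) (B l) (C k) (C l) (D k) (D l) a b ⟨
      (Z k *ₘ Z l) (a ↑ˡ s) (b ↑ˡ s)
        ≈⟨ commuting k l (a ↑ˡ s) (b ↑ˡ s) ⟩
      (Z l *ₘ Z k) (a ↑ˡ s) (b ↑ˡ s)
        ≈⟨ block-*ₘ-↑ˡ-↑ˡ (A l) (A k) (B l) (B k) (C l) (C k) (D l) (D k) a b ⟩
      (A l *ₘ A k) a b + (B l *ₘ C k) a b ∎)

    commutator-· : ∀ l u → ([ A k , A l ] · u) ≈ᵥ ((B k · (-ᵥ (C l · u))) +ᵥ (B l · (C k · u)))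
    commutator-· l u i = begin
      ([ A k , A l ] · u) i                         ≈⟨ ·-congˡ (commutator≈ l) u i ⟩
      (((B l *ₘ C k) -ₘ (B k *ₘ C l)) · u) i        ≈⟨ -ₘ-· (B l *ₘ C k) (B k *ₘ C l) u i ⟩
      ((B l *ₘ C k) · u) i - ((B k *ₘ C l) · u) i
        ≈⟨ +-cong (*ₘ-· (B l) (C k) u i) (-‿cong (*ₘ-· (B k) (C l) u i)) ⟩
      (B l · (C k · u)) i - (B k · (C l · u)) i     ≈⟨ +-comm _ _ ⟩
      - (B k · (C l · u)) i + (B l · (C k · u)) i   ≈⟨ +-congʳ (·-neg (B k) (C l · u) i) ⟨
      (B k · (-ᵥ (C l · u))) i + (B l · (C k · u)) i ∎

    Im-commutator⊆Im-B∣B : ∀ l → Im [ A k , A l ] ⊆ Im (B k ∣ B l)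
    Im-commutator⊆Im-B∣B l v (u , [Ak,Al]u≈v) =
      ((-ᵥ (C l · u)) ++ (C k · u)) ,
      λ i → trans (∣-·-++ (B k) (B l) _ _ i) (trans (sym (commutator-· l u i)) ([Ak,Al]u≈v i))

    Im-B⊆Im-commutator : ∀ l → HasDim (Im [ A k , A l ]) (s ℕ.+ s) → Im (B k) ⊆ Im [ A k , A l ]
    Im-B⊆Im-commutator l dim v (u , Bu≈v) =
      HasDim-⊆-Im⇒⊇ [ A k , A l ] (B k ∣ B l) dim (Im-commutator⊆Im-B∣B l) v (u ++ 0ᵥ , λ i → begin
        ((B k ∣ B l) · (u ++ 0ᵥ)) i ≈⟨ ∣-·-++ (B k) (B l) u 0ᵥ i ⟩
        (B k · u) i + (B l · 0ᵥ) i   ≈⟨ +-congˡ (·-zeroʳ (B l) (λ _ → refl) i) ⟩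
        (B k · u) i + 0#             ≈⟨ +-identityʳ _ ⟩
        (B k · u) i                  ≈⟨ Bu≈v i ⟩
        v i                          ∎)

    Im-commutators⊆Im-B∣B∣B : ∀ l m → (Im [ A k , A l ] ⊕ Im [ A k , A m ]) ⊆ Im (B k ∣ (B l ∣ B m))
    Im-commutators⊆Im-B∣B∣B l m v (v₁ , v₂ , (x , Px≈v₁) , (x′ , Qx′≈v₂) , v₁+v₂≈v) = y , λ i → begin
      ((B k ∣ (B l ∣ B m)) · y) i                         ≈⟨ ∣-·-++ (B k) (B l ∣ B m) _ _ i ⟩
      (B k · (a +ᵥ a′)) i + ((B l ∣ B m) · (b ++ b′)) i
        ≈⟨ +-cong (·-distrib-+ (B k) a a′ i) (∣-·-++ (B l) (B m) b b′ i) ⟩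
      ((B k · a) i + (B k · a′) i) + ((B l · b) i + (B m · b′) i)
        ≈⟨ interchange _ _ _ _ ⟩
      ((B k · a) i + (B l · b) i) + ((B k · a′) i + (B m · b′) i)
        ≈⟨ +-cong (commutator-· l x i) (commutator-· m x′ i) ⟨
      ([ A k , A l ] · x) i + ([ A k , A m ] · x′) i       ≈⟨ +-cong (Px≈v₁ i) (Qx′≈v₂ i) ⟩
      v₁ i + v₂ i                                         ≈⟨ v₁+v₂≈v i ⟩
      v i                                                 ∎
      where
        a = -ᵥ (C l · x)
        a′ = -ᵥ (C m · x′)
        b = C k · x
        b′ = C k · x′
        y = (a +ᵥ a′) ++ (b ++ b′)

    Im-commutators-∩⊆Im-B : ∀ l m → HasDim (Im [ A k , A l ] ⊕ Im [ A k , A m ]) (s ℕ.+ (s ℕ.+ s)) →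
                            (Im [ A k , A l ] ∩ Im [ A k , A m ]) ⊆ Im (B k)
    Im-commutators-∩⊆Im-B l m dim v ((x , Px≈v) , (x′ , Qx′≈v)) = a , λ i → begin
      (B k · a) i                 ≈⟨ +-identityʳ _ ⟨
      (B k · a) i + 0#            ≈⟨ +-congˡ (·-zeroʳ (B l) b≈0 i) ⟨
      (B k · a) i + (B l · b) i   ≈⟨ commutator-· l x i ⟨
      ([ A k , A l ] · x) i       ≈⟨ Px≈v i ⟩
      v i                         ∎
      where
        W = B k ∣ (B l ∣ B m)
        a = -ᵥ (C l · x)
        a′ = -ᵥ (C m · x′)
        b = C k · x
        b′ = C k · x′
        y = (a +ᵥ (-ᵥ a′)) ++ (b ++ (-ᵥ b′))

        Wy≈0 : (W · y) ≈ᵥ 0ᵥ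
        Wy≈0 i = begin
          (W · y) i                                      ≈⟨ ∣-·-++ (B k) (B l ∣ B m) _ _ i ⟩
          (B k · (a +ᵥ (-ᵥ a′))) i + ((B l ∣ B m) · (b ++ (-ᵥ b′))) i
            ≈⟨ +-cong (·-distrib-+ (B k) a (-ᵥ a′) i) (∣-·-++ (B l) (B m) b (-ᵥ b′) i) ⟩
          ((B k · a) i + (B k · (-ᵥ a′)) i) + ((B l · b) i + (B m · (-ᵥ b′)) i)
            ≈⟨ +-cong (+-congˡ (·-neg (B k) a′ i)) (+-congˡ (·-neg (B m) b′ i)) ⟩
          ((B k · a) i - (B k · a′) i) + ((B l · b) i - (B m · b′) i)
            ≈⟨ [x-y]+[z-w]≈[x+z]-[y+w] _ _ _ _ ⟩
          ((B k · a) i + (B l · b) i) - ((B k · a′) i + (B m · b′) i)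
            ≈⟨ +-cong (commutator-· l x i) (-‿cong (commutator-· m x′ i)) ⟨
          ([ A k , A l ] · x) i - ([ A k , A m ] · x′) i  ≈⟨ +-cong (Px≈v i) (-‿cong (Qx′≈v i)) ⟩
          v i - v i                                      ≈⟨ -‿inverseʳ _ ⟩
          0#                                             ∎

        b≈0 : b ≈ᵥ 0ᵥ
        b≈0 j = begin
          b j                      ≡⟨ lookup-++ˡ b (-ᵥ b′) j ⟨
          (b ++ (-ᵥ b′)) (j ↑ˡ s) ≡⟨ lookup-++ʳ (a +ᵥ (-ᵥ a′)) (b ++ (-ᵥ b′)) (j ↑ˡ s) ⟨
          y (s ↑ʳ (j ↑ˡ s))        ≈⟨ HasDim-⊆-Im⇒Injective W dim (Im-commutators⊆Im-B∣B∣B l m) y Wy≈0 _ ⟩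
          0#                ∎

open import Data.Nat using (_*_)

corollary1 : ∀ {c ℓ} (K : Field c ℓ) (n s p : ℕ)
    → let open LinAlg K in
      (A : Fin p → Matrix n n) (B : Fin p → Matrix n s)
      (C : Fin p → Matrix s n) (D : Fin p → Matrix s s)
    → CommutingExtension A B C D
    → (k l m : Fin p) → k ≢ l → k ≢ m → l ≢ m
    → HasDim (Im [ A k , A l ] ⊕ Im [ A k , A m ]) (3 * s)
    → HasDim (Im [ A k , A l ]) (2 * s)
    → HasDim (Im [ A k , A m ]) (2 * s)
    → Im (B k) ≐ (Im [ A k , A l ] ∩ Im [ A k , A m ])
corollary1 K n s p A B C D commuting k l m _ _ _ dim[kl]⊕[km] dim[kl] dim[km] v =
    (λ v∈ImB → Im-B⊆Im-commutator l (≡.subst (HasDim _) 2s≡s+s dim[kl]) v v∈ImB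
             , Im-B⊆Im-commutator m (≡.subst (HasDim _) 2s≡s+s dim[km]) v v∈ImB)
  , Im-commutators-∩⊆Im-B l m (≡.subst (HasDim _) 3s≡s+[s+s] dim[kl]⊕[km]) v
  where
    open LinAlg K
    open LinearAlgebra K
    open CommutingExtensionProperties A B C D commuting k
    2s≡s+s = ≡.cong (s ℕ.+_) (ℕₚ.+-identityʳ s)
    3s≡s+[s+s] = ≡.cong (λ t → s ℕ.+ (s ℕ.+ t)) (ℕₚ.+-identityʳ s)
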